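{- Let $p\ge 3$, let $k\ge 1$, and let $G=K_{n_1,\dots,n_p}$ be the complete $p$-partite graph of order $n=n_1+\dots+n_p$. If $\gamma_{\times k,t}^{r}(G)<n$, then $$\left\lceil \frac{kp}{p-1}\right\rceil\le \gamma_{\times k,t}^{r}(G)\le n-k.$$
   Context: All graphs are finite and simple; $N(x)$ denotes the open neighborhood of $x$. For an integer $k\ge 1$, a set $S\subseteq V(G)$ is a $k$-tuple total dominating set of $G$ if $|N(x)\cap S|\ge k$ for every $x\in V(G)$. It is a $k$-tuple total restrained dominating set (kTRDS) if moreover every vertex $x\in V(G)\setminus S$ is adjacent to at least $k$ vertices of $V(G)\setminus S$. For a graph with minimum degree at least $k$, $\gamma_{\times k,t}^{r}(G)$ denotes the minimum cardinality of a kTRDS of $G$. $K_{n_1,\dots,n_p}$ is the complete $p$-partite graph with parts of sizes $n_1,\dots,n_p$. -}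

module Defs where

open import Data.Nat using (ℕ; zero; suc; _+_; _*_; _∸_; _≤_; _<_)
open import Data.Nat.DivMod using (_/_)
open import Data.Fin using (Fin; _≟_)
open import Data.Fin.Subset using (Subset; ∣_∣; _∩_; _∈_; _∉_; ∁)
open import Data.Vec using (tabulate)
open import Data.Bool using (not)
open import Data.Product using (Σ; _×_)
open import Relation.Nullary.Decidable using (⌊_⌋)

-- A finite simple graph on vertex set Fin N, given by its (decidable)
-- adjacency as the open-neighbourhood map  x ↦ N(x) ⊆ V.
record Graph (N : ℕ) : Set where
  field
    nbhd : Fin N → Subset N
open Graph public

-- Complete p-partite graph on Fin N: vertex x lies in part (part x);
-- two vertices are adjacent iff they lie in different parts.
-- (The part function is required to be surjective, i.e. all n_i ≥ 1;
-- then n_i = |part⁻¹(i)| and N = n_1 + … + n_p.)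
completeMultipartite : ∀ {N p} → (Fin N → Fin p) → Graph N
completeMultipartite part =
  record { nbhd = λ x → tabulate (λ y → not ⌊ part x ≟ part y ⌋) }

Surjective : ∀ {N p} → (Fin N → Fin p) → Set
Surjective {N} {p} f = (i : Fin p) → Σ (Fin N) (λ x → f x ≡ i)
  where open import Relation.Binary.PropositionalEquality using (_≡_)

MinDegreeAtLeast : ∀ {N} → Graph N → ℕ → Set
MinDegreeAtLeast {N} G k = (x : Fin N) → k ≤ ∣ nbhd G x ∣

IsKTRDS : ∀ {N} → Graph N → ℕ → Subset N → Set
IsKTRDS {N} G k S =
  ((x : Fin N) → k ≤ ∣ nbhd G x ∩ S ∣) ×
  ((x : Fin N) → x ∉ S → k ≤ ∣ nbhd G x ∩ ∁ S ∣)

IsKTRDNumber : ∀ {N} → Graph N → ℕ → ℕ → Set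
IsKTRDNumber {N} G k m =
  Σ (Subset N) (λ S → IsKTRDS G k S × ∣ S ∣ ≡ m) ×
  ((S : Subset N) → IsKTRDS G k S → m ≤ ∣ S ∣)
  where open import Relation.Binary.PropositionalEquality using (_≡_)

-- ceiling division ⌈a / b⌉ (b > 0; value 0 for b = 0, never used)
ceilDiv : ℕ → ℕ → ℕ
ceilDiv a zero = 0
ceilDiv a (suc b) = (a + b) / suc b

-- Let S be a k-tuple total restrained dominating set with |S| < n. A vertex outside S has
-- k neighbours outside S, so n - |S| ≥ k. Inside S, a vertex of the part V_i is adjacent
-- exactly to S ∖ V_i, so k + |S ∩ V_i| ≤ |S| for every part; summing over the p parts gives
-- pk + |S| ≤ p|S|, that is kp ≤ (p - 1)|S|.
module Submission where

open import Defs
open import Data.Bool using (Bool; true; false; not; _∧_)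
open import Data.Fin using (Fin; zero; suc; _≟_)
open import Data.Fin.Subset using (Subset; ∣_∣; _∩_; _∉_; ∁; inside; outside)
open import Data.Fin.Subset.Properties using (∣∁p∣≡n∸∣p∣; ∣p∩q∣≤∣q∣)
open import Data.Nat using (ℕ; zero; suc; _+_; _*_; _∸_; _≤_; _<_; z≤n; s≤s; s≤s⁻¹)
open import Data.Nat.DivMod using (m<n*o⇒m/o<n)
open import Data.Nat.Properties
  using (+-0-commutativeMonoid; +-comm; +-suc; +-identityʳ; *-comm; *-suc;
         +-mono-≤; +-monoˡ-≤; +-mono-≤-<; +-cancelˡ-≤; ≤-refl; ≤-trans; ≤-reflexive; <⇒≤; n<1+n;
         m+n≤o⇒m≤o∸n; m≤o∸n⇒m+n≤o; module ≤-Reasoning)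
open import Data.Product using (Σ; _×_; _,_)
open import Data.Vec using ([]; _∷_; tabulate)
open import Data.Vec.Functional using (Vector)
open import Data.Vec.Base using (there)
open import Function using (_∘_)
open import Relation.Binary.PropositionalEquality
  using (_≡_; refl; sym; trans; cong; cong₂; subst; module ≡-Reasoning)
open import Relation.Nullary.Decidable using (⌊_⌋; ⌊⌋-map′)

open import Algebra.Properties.CommutativeMonoid.Sum +-0-commutativeMonoid
  using (sum; sum-syntax; ∑-distrib-+; sum-cong-≗; sum-replicate-zero)

sum-const : ∀ n (c : ℕ) → sum {n} (λ _ → c) ≡ n * c
sum-const zero    c = refl
sum-const (suc n) c = cong (c +_) (sum-const n c)

sum-mono-≤ : ∀ {n} {f g : Vector ℕ n} → (∀ i → f i ≤ g i) → sum f ≤ sum g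
sum-mono-≤ {zero}  f≤g = z≤n
sum-mono-≤ {suc n} f≤g = +-mono-≤ (f≤g zero) (sum-mono-≤ (f≤g ∘ suc))

indicator : Bool → ℕ
indicator false = 0
indicator true  = 1

∣x∷p∣≡indicator+∣p∣ : ∀ {n} x (p : Subset n) → ∣ x ∷ p ∣ ≡ indicator x + ∣ p ∣
∣x∷p∣≡indicator+∣p∣ true  p = refl
∣x∷p∣≡indicator+∣p∣ false p = refl

∑-indicator-≟-∧ : ∀ {n} (j : Fin n) b → sum (λ i → indicator (⌊ i ≟ j ⌋ ∧ b)) ≡ indicator b
∑-indicator-≟-∧ {suc n} zero    b =
  trans (cong (indicator b +_) (sum-replicate-zero n)) (+-identityʳ _)
∑-indicator-≟-∧ {suc n} (suc j) b =
  trans (sum-cong-≗ (λ i → cong (λ c → indicator (c ∧ b)) (⌊⌋-map′ _ _ (i ≟ j))))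
        (∑-indicator-≟-∧ j b)

∣p∣<n⇒∃∉ : ∀ {n} (p : Subset n) → ∣ p ∣ < n → Σ (Fin n) (_∉ p)
∣p∣<n⇒∃∉ (outside ∷ p) _ = zero , λ ()
∣p∣<n⇒∃∉ (inside  ∷ p) ∣p∣<n with ∣p∣<n⇒∃∉ p (s≤s⁻¹ ∣p∣<n)
... | x , x∉p = suc x , λ { (there x∈p) → x∉p x∈p }

∣tabulate-not∩p∣+∣tabulate∩p∣≡∣p∣ : ∀ {n} (f : Fin n → Bool) (p : Subset n) →
  ∣ tabulate (not ∘ f) ∩ p ∣ + ∣ tabulate f ∩ p ∣ ≡ ∣ p ∣
∣tabulate-not∩p∣+∣tabulate∩p∣≡∣p∣ f [] = refl
∣tabulate-not∩p∣+∣tabulate∩p∣≡∣p∣ f (x ∷ p) with f zero | x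
... | true  | true  = trans (+-suc _ _) (cong suc ih)
  where ih = ∣tabulate-not∩p∣+∣tabulate∩p∣≡∣p∣ (f ∘ suc) p
... | true  | false = ∣tabulate-not∩p∣+∣tabulate∩p∣≡∣p∣ (f ∘ suc) p
... | false | true  = cong suc (∣tabulate-not∩p∣+∣tabulate∩p∣≡∣p∣ (f ∘ suc) p)
... | false | false = ∣tabulate-not∩p∣+∣tabulate∩p∣≡∣p∣ (f ∘ suc) p

ceilDiv-least : ∀ a d m → a ≤ suc d * m → ceilDiv a (suc d) ≤ m
ceilDiv-least a d m a≤[1+d]m = s≤s⁻¹ (m<n*o⇒m/o<n a+d<[1+m][1+d])
  where
  open ≤-Reasoning
  a+d<[1+m][1+d] : a + d < suc m * suc d
  a+d<[1+m][1+d] = begin-strict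
    a + d                ≤⟨ +-monoˡ-≤ d a≤[1+d]m ⟩
    suc d * m + d        <⟨ +-mono-≤-< ≤-refl (n<1+n d) ⟩
    suc d * m + suc d    ≡⟨ +-comm (suc d * m) (suc d) ⟩
    suc d + suc d * m    ≡⟨ *-suc (suc d) m ⟨
    suc d * suc m        ≡⟨ *-comm (suc d) (suc m) ⟩
    suc m * suc d        ∎

[1+d]k+m≤[1+d]m⇒k[1+d]≤dm : ∀ d k m → suc d * k + m ≤ suc d * m → k * suc d ≤ d * m
[1+d]k+m≤[1+d]m⇒k[1+d]≤dm d k m ineq =
  subst (_≤ d * m) (*-comm (suc d) k)
        (+-cancelˡ-≤ m _ _ (subst (_≤ m + d * m) (+-comm _ m) ineq))

kTRDS∧∣S∣<N⇒∣S∣≤N∸k : ∀ {N} (G : Graph N) {k S} →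
  IsKTRDS G k S → ∣ S ∣ < N → ∣ S ∣ ≤ N ∸ k
kTRDS∧∣S∣<N⇒∣S∣≤N∸k {N} G {k} {S} (_ , restrained) ∣S∣<N
  with ∣p∣<n⇒∃∉ S ∣S∣<N
... | x , x∉S = m+n≤o⇒m≤o∸n ∣ S ∣ ∣S∣+k≤N
  where
  open ≤-Reasoning
  k≤N∸∣S∣ : k ≤ N ∸ ∣ S ∣
  k≤N∸∣S∣ = begin
    k                     ≤⟨ restrained x x∉S ⟩
    ∣ nbhd G x ∩ ∁ S ∣    ≤⟨ ∣p∩q∣≤∣q∣ (nbhd G x) (∁ S) ⟩
    ∣ ∁ S ∣               ≡⟨ ∣∁p∣≡n∸∣p∣ S ⟩
    N ∸ ∣ S ∣             ∎
  ∣S∣+k≤N : ∣ S ∣ + k ≤ N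
  ∣S∣+k≤N = subst (_≤ N) (+-comm k ∣ S ∣) (m≤o∸n⇒m+n≤o k (<⇒≤ ∣S∣<N) k≤N∸∣S∣)

partClass : ∀ {N p} → (Fin N → Fin p) → Fin p → Subset N
partClass part i = tabulate (λ y → ⌊ i ≟ part y ⌋)

∑∣partClass∩S∣≡∣S∣ : ∀ {N p} (part : Fin N → Fin p) (S : Subset N) →
  ∑[ i < p ] ∣ partClass part i ∩ S ∣ ≡ ∣ S ∣
∑∣partClass∩S∣≡∣S∣ {zero}  {p} part []      = sum-replicate-zero p
∑∣partClass∩S∣≡∣S∣ {suc N} {p} part (x ∷ S) = begin
  ∑[ i < p ] ∣ (⌊ i ≟ part zero ⌋ ∧ x) ∷ (partClass (part ∘ suc) i ∩ S) ∣
    ≡⟨ sum-cong-≗ {p} (λ i → ∣x∷p∣≡indicator+∣p∣ _ (partClass (part ∘ suc) i ∩ S)) ⟩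
  ∑[ i < p ] (indicator (⌊ i ≟ part zero ⌋ ∧ x) + ∣ partClass (part ∘ suc) i ∩ S ∣)
    ≡⟨ ∑-distrib-+ {p} _ _ ⟩
  ∑[ i < p ] indicator (⌊ i ≟ part zero ⌋ ∧ x) +
  ∑[ i < p ] ∣ partClass (part ∘ suc) i ∩ S ∣
    ≡⟨ cong₂ _+_ (∑-indicator-≟-∧ (part zero) x) (∑∣partClass∩S∣≡∣S∣ (part ∘ suc) S) ⟩
  indicator x + ∣ S ∣
    ≡⟨ sym (∣x∷p∣≡indicator+∣p∣ x S) ⟩
  ∣ x ∷ S ∣ ∎
  where open ≡-Reasoning

module _ {N p} (part : Fin N → Fin p) where

  private
    G : Graph N
    G = completeMultipartite part

  ∣nbhd∩S∣+∣partClass∩S∣≡∣S∣ : ∀ x S →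
    ∣ nbhd G x ∩ S ∣ + ∣ partClass part (part x) ∩ S ∣ ≡ ∣ S ∣
  ∣nbhd∩S∣+∣partClass∩S∣≡∣S∣ x =
    ∣tabulate-not∩p∣+∣tabulate∩p∣≡∣p∣ (λ y → ⌊ part x ≟ part y ⌋)

  multipartite-p*k+∣S∣≤p*∣S∣ : Surjective part → ∀ {k S} →
    ((x : Fin N) → k ≤ ∣ nbhd G x ∩ S ∣) → p * k + ∣ S ∣ ≤ p * ∣ S ∣
  multipartite-p*k+∣S∣≤p*∣S∣ surjective {k} {S} dominating = begin
    p * k + ∣ S ∣
      ≡⟨ cong₂ _+_ (sym (sum-const p k)) (sym (∑∣partClass∩S∣≡∣S∣ part S)) ⟩
    ∑[ i < p ] k + ∑[ i < p ] ∣ partClass part i ∩ S ∣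
      ≡⟨ sym (∑-distrib-+ {p} _ _) ⟩
    ∑[ i < p ] (k + ∣ partClass part i ∩ S ∣)
      ≤⟨ sum-mono-≤ k+∣partClass∩S∣≤∣S∣ ⟩
    ∑[ i < p ] ∣ S ∣
      ≡⟨ sum-const p ∣ S ∣ ⟩
    p * ∣ S ∣ ∎
    where
    open ≤-Reasoning
    k+∣partClass∩S∣≤∣S∣ : ∀ i → k + ∣ partClass part i ∩ S ∣ ≤ ∣ S ∣
    k+∣partClass∩S∣≤∣S∣ i with surjective i
    ... | x , refl = ≤-trans (+-monoˡ-≤ _ (dominating x))
                             (≤-reflexive (∣nbhd∩S∣+∣partClass∩S∣≡∣S∣ x S))

proposition2p7 : (p k N m : ℕ) → 3 ≤ p → 1 ≤ k →
    (part : Fin N → Fin p) → Surjective part →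
    MinDegreeAtLeast (completeMultipartite part) k →
    IsKTRDNumber (completeMultipartite part) k m →
    m < N →
    (ceilDiv (k * p) (p ∸ 1) ≤ m) × (m ≤ N ∸ k)
proposition2p7 p@(suc d@(suc e)) k N _ (s≤s (s≤s _)) _ part surjective _
               ((S , kTRDS@(dominating , _) , refl) , _) ∣S∣<N =
  ceilDiv-least (k * p) e ∣ S ∣ kp≤[p∸1]∣S∣ ,
  kTRDS∧∣S∣<N⇒∣S∣≤N∸k (completeMultipartite part) kTRDS ∣S∣<N
  where
  kp≤[p∸1]∣S∣ : k * p ≤ d * ∣ S ∣
  kp≤[p∸1]∣S∣ = [1+d]k+m≤[1+d]m⇒k[1+d]≤dm d k ∣ S ∣
                  (multipartite-p*k+∣S∣≤p*∣S∣ part surjective dominating)
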